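{- Let $d\geq 0$ be an integer. For every integer $n\geq d$ there is a $d$-degenerate graph $G_n$ with $n$ vertices and exactly $2^d(n-d+1)$ cliques, which moreover contains a $d$-clique.
   Context: All graphs are finite, simple and undirected. A graph is $d$-degenerate if every subgraph of it has a vertex of degree at most $d$. A clique is a (possibly empty) set of pairwise adjacent vertices, and a $k$-clique is a clique of cardinality $k$; the number of cliques counts $\emptyset$ and single vertices. -}

module Defs where

open import Data.Nat using (ℕ; _≤_)
open import Data.Bool using (Bool; true; false; _∧_)
open import Data.Fin using (Fin)
open import Data.Fin.Subset using (Subset; _∈_)
open import Data.Fin.Subset.Properties using (_∈?_)
open import Data.List using (List; length; filterᵇ; allFin)
open import Data.List.Relation.Unary.Unique.Propositional using (Unique)
import Data.List.Membership.Propositional as LM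
open import Data.Product using (Σ; ∃; _×_; _,_)
open import Relation.Nullary using (¬_)
open import Relation.Nullary.Decidable using (⌊_⌋)
open import Relation.Binary.PropositionalEquality using (_≡_; _≢_)
open import Function.Bundles using (_⇔_)

record Graph (n : ℕ) : Set where
  field
    adj     : Fin n → Fin n → Bool
    symm    : ∀ i j → adj i j ≡ adj j i
    irrefl  : ∀ i → adj i i ≡ false
open Graph public

IsClique : ∀ {n} → Graph n → Subset n → Set
IsClique G S = ∀ i j → i ∈ S → j ∈ S → i ≢ j → adj G i j ≡ true

record Subgraph {n : ℕ} (G : Graph n) : Set where
  field
    verts    : Subset n
    edges    : Fin n → Fin n → Bool
    edges-sym : ∀ i j → edges i j ≡ edges j i
    edges-⊆  : ∀ i j → edges i j ≡ true → adj G i j ≡ true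
    edges-in : ∀ i j → edges i j ≡ true → i ∈ verts
open Subgraph public

degreeIn : ∀ {n} {G : Graph n} → Subgraph G → Fin n → ℕ
degreeIn {n} H v = length (filterᵇ (λ j → edges H v j ∧ ⌊ j ∈? verts H ⌋) (allFin n))

Degenerate : ∀ {n} → ℕ → Graph n → Set
Degenerate d G = ∀ (H : Subgraph G) → ∃ (λ v → v ∈ verts H) →
  ∃ λ v → v ∈ verts H × degreeIn H v ≤ d

NumCliques : ∀ {n} → Graph n → ℕ → Set
NumCliques {n} G m = Σ (List (Subset n)) λ cs →
  Unique cs × length cs ≡ m × (∀ S → (S LM.∈ cs) ⇔ IsClique G S)

{-# OPTIONS --safe #-}
-- G_n is the join of a d-clique (the core) with an edgeless graph on m = n − d vertices,
-- obtained by adding d universal vertices one at a time. A universal vertex can be added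
-- to any clique or not, so it doubles the number of cliques, and the edgeless graph on
-- m vertices has m + 1 cliques (∅ and the singletons). For degeneracy: a vertex outside
-- the core has all its neighbours in the core, and a subgraph without such a vertex lies
-- inside the core, so in either case some vertex has degree at most d.
module Submission where

open import Defs
open import Data.Nat using (ℕ; _≤_; _+_; _∸_; _*_; _^_; zero; suc)
open import Data.Nat.Properties using (*-identityˡ; *-assoc; +-comm; +-identityʳ; m+n∸m≡n; m≤n⇒∃[o]m+o≡n; module ≤-Reasoning)
open import Data.Bool using (Bool; true; false; T; _∧_)
open import Data.Bool.Properties using (T-≡; T-∧)
open import Data.Fin as Fin using (Fin; zero; suc; _≟_)
open import Data.Fin.Properties using (any?; suc-injective)
open import Data.Fin.Subset using (Subset; ∣_∣; _∈_; _∉_; ⊥; ⁅_⁆; inside; outside)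
open import Data.Fin.Subset.Properties using (_∈?_; drop-there; ∣⊥∣≡0; ∉⊥; x∈⁅x⁆; x∈⁅y⁆⇒x≡y; nonempty?; Empty-unique; ⊆-antisym)
open import Data.Vec using ([]; _∷_; here; there)
open import Data.Vec.Properties using (∷-injectiveʳ)
open import Data.List using (List; []; _∷_; length; filterᵇ; allFin; map; tabulate; _++_)
open import Data.List.Properties using (length-map; length-++; length-tabulate; map-tabulate)
open import Data.List.Membership.Propositional using () renaming (_∈_ to _∈ₗ_)
open import Data.List.Membership.Propositional.Properties using (∈-map⁺; ∈-map⁻; ∈-++⁺ˡ; ∈-++⁺ʳ; ∈-++⁻; ∈-tabulate⁺; ∈-tabulate⁻)
open import Data.List.Relation.Unary.Any using () renaming (here to hereₗ; there to thereₗ)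
open import Data.List.Relation.Unary.All.Properties using () renaming (tabulate⁺ to All-tabulate⁺)
open import Data.List.Relation.Unary.AllPairs using (_∷_)
open import Data.List.Relation.Unary.Unique.Propositional using (Unique)
open import Data.List.Relation.Unary.Unique.Propositional.Properties using (map⁺; ++⁺; tabulate⁺)
open import Data.List.Relation.Binary.Sublist.Propositional using (⊆-refl)
open import Data.List.Relation.Binary.Sublist.Propositional.Properties using (filter⁺; length-mono-≤)
open import Data.Product using (Σ; ∃; _×_; _,_)
open import Data.Sum using (inj₁; inj₂)
open import Data.Empty using (⊥-elim)
open import Function using (_∘_; id)
open import Function.Bundles using (_⇔_; mk⇔; Equivalence)
import Function.Properties.Equivalence as ⇔
open import Relation.Nullary using (¬_; yes; no; ¬?; contradiction)
open import Relation.Nullary.Decidable using (⌊_⌋; ⌊⌋-map′; _×-dec_; T?; toWitness; fromWitness; decidable-stable)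
open import Relation.Binary.PropositionalEquality using (_≡_; _≢_; refl; sym; trans; cong; cong₂; subst; module ≡-Reasoning)

length-filterᵇ-mono : ∀ {A : Set} {p q : A → Bool} → (∀ x → T (p x) → T (q x)) →
  ∀ xs → length (filterᵇ p xs) ≤ length (filterᵇ q xs)
length-filterᵇ-mono {p = p} {q} p⇒q xs =
  length-mono-≤ (filter⁺ (T? ∘ p) (T? ∘ q) (λ { refl → p⇒q _ }) (⊆-refl {x = xs}))

-- Stated up to a pointwise equation because ⌊_⌋ (that is, isYes) does not compute
-- through Dec.map′, so ⌊ suc j ∈? b ∷ S ⌋ and ⌊ j ∈? S ⌋ are only propositionally equal.
length-filterᵇ-map : ∀ {A B : Set} {p : B → Bool} {q : A → Bool} (f : A → B) →
  (∀ x → p (f x) ≡ q x) → ∀ xs → length (filterᵇ p (map f xs)) ≡ length (filterᵇ q xs)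
length-filterᵇ-map f p∘f≗q [] = refl
length-filterᵇ-map {q = q} f p∘f≗q (x ∷ xs) rewrite p∘f≗q x with q x
... | true  = cong suc (length-filterᵇ-map f p∘f≗q xs)
... | false = length-filterᵇ-map f p∘f≗q xs

length-filter-∈-tabulate-suc : ∀ {n} b (S : Subset n) →
  length (filterᵇ (λ j → ⌊ j ∈? b ∷ S ⌋) (tabulate suc)) ≡ length (filterᵇ (λ j → ⌊ j ∈? S ⌋) (allFin n))
length-filter-∈-tabulate-suc {n} b S = begin
  length (filterᵇ (λ j → ⌊ j ∈? b ∷ S ⌋) (tabulate suc))
    ≡⟨ cong (length ∘ filterᵇ (λ j → ⌊ j ∈? b ∷ S ⌋)) (sym (map-tabulate {n = n} id Fin.suc)) ⟩
  length (filterᵇ (λ j → ⌊ j ∈? b ∷ S ⌋) (map suc (allFin n)))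
    ≡⟨ length-filterᵇ-map suc (λ j → ⌊⌋-map′ there drop-there (j ∈? S)) (allFin n) ⟩
  length (filterᵇ (λ j → ⌊ j ∈? S ⌋) (allFin n))
    ∎
  where open ≡-Reasoning

length-filter-∈≡∣S∣ : ∀ {n} (S : Subset n) → length (filterᵇ (λ j → ⌊ j ∈? S ⌋) (allFin n)) ≡ ∣ S ∣
length-filter-∈≡∣S∣ [] = refl
length-filter-∈≡∣S∣ (inside ∷ S)  =
  cong suc (trans (length-filter-∈-tabulate-suc inside S) (length-filter-∈≡∣S∣ S))
length-filter-∈≡∣S∣ (outside ∷ S) =
  trans (length-filter-∈-tabulate-suc outside S) (length-filter-∈≡∣S∣ S)

degreeIn≤∣S∣ : ∀ {n} {G : Graph n} (H : Subgraph G) v (S : Subset n) →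
  (∀ j → edges H v j ≡ true → j ∈ verts H → j ∈ S) → degreeIn H v ≤ ∣ S ∣
degreeIn≤∣S∣ {n} H v S neighbours⊆S = begin
  degreeIn H v                                   ≤⟨ length-filterᵇ-mono ∈S (allFin n) ⟩
  length (filterᵇ (λ j → ⌊ j ∈? S ⌋) (allFin n)) ≡⟨ length-filter-∈≡∣S∣ S ⟩
  ∣ S ∣                                          ∎
  where
  open ≤-Reasoning
  ∈S : ∀ j → T (edges H v j ∧ ⌊ j ∈? verts H ⌋) → T ⌊ j ∈? S ⌋
  ∈S j t with e , j∈H ← Equivalence.to T-∧ t =
    fromWitness (neighbours⊆S j (Equivalence.to T-≡ e) (toWitness j∈H))

emptyGraph : ∀ m → Graph m
emptyGraph m = record { adj = λ _ _ → false ; symm = λ _ _ → refl ; irrefl = λ _ → refl }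

cone : ∀ {n} → Graph n → Graph (suc n)
cone {n} G = record { adj = adj′ ; symm = symm′ ; irrefl = irrefl′ }
  where
  adj′ : Fin (suc n) → Fin (suc n) → Bool
  adj′ zero    zero    = false
  adj′ zero    (suc j) = true
  adj′ (suc i) zero    = true
  adj′ (suc i) (suc j) = adj G i j

  symm′ : ∀ i j → adj′ i j ≡ adj′ j i
  symm′ zero    zero    = refl
  symm′ zero    (suc j) = refl
  symm′ (suc i) zero    = refl
  symm′ (suc i) (suc j) = symm G i j

  irrefl′ : ∀ i → adj′ i i ≡ false
  irrefl′ zero    = refl
  irrefl′ (suc i) = irrefl G i

completeSplit : ∀ d m → Graph (d + m)
completeSplit zero    m = emptyGraph m
completeSplit (suc d) m = cone (completeSplit d m)

core : ∀ d m → Subset (d + m)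
core zero    m = ⊥
core (suc d) m = inside ∷ core d m

∣core∣≡d : ∀ d m → ∣ core d m ∣ ≡ d
∣core∣≡d zero    m = ∣⊥∣≡0 m
∣core∣≡d (suc d) m = cong suc (∣core∣≡d d m)

adj⇒∈core : ∀ d m {i j} → adj (completeSplit d m) i j ≡ true → i ∉ core d m → j ∈ core d m
adj⇒∈core zero    m         ()
adj⇒∈core (suc d) m {zero}          _     i∉core = ⊥-elim (i∉core here)
adj⇒∈core (suc d) m {suc i} {zero}  _     _      = here
adj⇒∈core (suc d) m {suc i} {suc j} i~j   i∉core = there (adj⇒∈core d m i~j (i∉core ∘ there))

∃-vertex-with-neighbours-in-core : ∀ d m (H : Subgraph (completeSplit d m)) → ∃ (_∈ verts H) →
  ∃ λ v → v ∈ verts H × (∀ j → edges H v j ≡ true → j ∈ verts H → j ∈ core d m)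
∃-vertex-with-neighbours-in-core d m H (v₀ , v₀∈H)
  with any? (λ v → (v ∈? verts H) ×-dec ¬? (v ∈? core d m))
... | yes (v , v∈H , v∉core) = v , v∈H , λ j v~j _ → adj⇒∈core d m (edges-⊆ H v j v~j) v∉core
... | no ∄v∉core = v₀ , v₀∈H , λ j _ j∈H →
  decidable-stable (j ∈? core d m) (λ j∉core → ∄v∉core (j , j∈H , j∉core))

completeSplit-degenerate : ∀ d m → Degenerate d (completeSplit d m)
completeSplit-degenerate d m H nonempty
  with v , v∈H , neighbours⊆core ← ∃-vertex-with-neighbours-in-core d m H nonempty =
  v , v∈H , subst (degreeIn H v ≤_) (∣core∣≡d d m) (degreeIn≤∣S∣ H v (core d m) neighbours⊆core)

cone-isClique⇔ : ∀ {n} {G : Graph n} {b} {S : Subset n} → IsClique (cone G) (b ∷ S) ⇔ IsClique G S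
cone-isClique⇔ {G = G} {b} {S} = mk⇔ restrict extend
  where
  restrict : IsClique (cone G) (b ∷ S) → IsClique G S
  restrict clique i j i∈S j∈S i≢j = clique (suc i) (suc j) (there i∈S) (there j∈S) (i≢j ∘ suc-injective)

  extend : IsClique G S → IsClique (cone G) (b ∷ S)
  extend clique zero    zero    _           _           0≢0 = contradiction refl 0≢0
  extend clique zero    (suc j) _           _           _   = refl
  extend clique (suc i) zero    _           _           _   = refl
  extend clique (suc i) (suc j) (there i∈S) (there j∈S) i≢j = clique i j i∈S j∈S (i≢j ∘ cong suc)

withOrWithoutZero : ∀ {n} → List (Subset n) → List (Subset (suc n))
withOrWithoutZero Ss = map (inside ∷_) Ss ++ map (outside ∷_) Ss

length-withOrWithoutZero : ∀ {n} (Ss : List (Subset n)) → length (withOrWithoutZero Ss) ≡ 2 * length Ss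
length-withOrWithoutZero Ss = begin
  length (map (inside ∷_) Ss ++ map (outside ∷_) Ss)      ≡⟨ length-++ (map (inside ∷_) Ss) ⟩
  length (map (inside ∷_) Ss) + length (map (outside ∷_) Ss) ≡⟨ cong₂ _+_ (length-map _ Ss) (length-map _ Ss) ⟩
  length Ss + length Ss                                      ≡⟨ cong (length Ss +_) (sym (+-identityʳ (length Ss))) ⟩
  2 * length Ss                                              ∎
  where open ≡-Reasoning

withOrWithoutZero-Unique : ∀ {n} {Ss : List (Subset n)} → Unique Ss → Unique (withOrWithoutZero Ss)
withOrWithoutZero-Unique unique = ++⁺ (map⁺ ∷-injectiveʳ unique) (map⁺ ∷-injectiveʳ unique) disjoint
  where
  disjoint : ∀ {S} → ¬ (S ∈ₗ map (inside ∷_) _ × S ∈ₗ map (outside ∷_) _)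
  disjoint (S∈ₗin , S∈ₗout) with _ , _ , refl ← ∈-map⁻ (inside ∷_) S∈ₗin
                             with _ , _ , () ← ∈-map⁻ (outside ∷_) S∈ₗout

∈-withOrWithoutZero⇔ : ∀ {n} {Ss : List (Subset n)} {b S} → (b ∷ S) ∈ₗ withOrWithoutZero Ss ⇔ S ∈ₗ Ss
∈-withOrWithoutZero⇔ {Ss = Ss} {b} {S} = mk⇔ to from
  where
  to : (b ∷ S) ∈ₗ withOrWithoutZero Ss → S ∈ₗ Ss
  to S∈ₗ with ∈-++⁻ (map (inside ∷_) Ss) S∈ₗ
  ... | inj₁ S∈ₗin  with _ , S∈ₗSs , refl ← ∈-map⁻ (inside ∷_) S∈ₗin = S∈ₗSs
  ... | inj₂ S∈ₗout with _ , S∈ₗSs , refl ← ∈-map⁻ (outside ∷_) S∈ₗout = S∈ₗSs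

  from : ∀ {b} → S ∈ₗ Ss → (b ∷ S) ∈ₗ withOrWithoutZero Ss
  from {inside}  S∈ₗSs = ∈-++⁺ˡ (∈-map⁺ (inside ∷_) S∈ₗSs)
  from {outside} S∈ₗSs = ∈-++⁺ʳ (map (inside ∷_) Ss) (∈-map⁺ (outside ∷_) S∈ₗSs)

cone-NumCliques : ∀ {n} {G : Graph n} {k} → NumCliques G k → NumCliques (cone G) (2 * k)
cone-NumCliques {G = G} (Ss , unique , length≡k , ∈⇔clique) =
  withOrWithoutZero Ss , withOrWithoutZero-Unique unique ,
  trans (length-withOrWithoutZero Ss) (cong (2 *_) length≡k) ,
  λ { (b ∷ S) → ⇔.trans ∈-withOrWithoutZero⇔ (⇔.trans (∈⇔clique S) (⇔.sym cone-isClique⇔)) }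

emptyGraph-isClique⇒≡ : ∀ {m} {S : Subset m} → IsClique (emptyGraph m) S → ∀ {i j} → i ∈ S → j ∈ S → i ≡ j
emptyGraph-isClique⇒≡ clique {i} {j} i∈S j∈S =
  decidable-stable (i ≟ j) (λ i≢j → contradiction (clique i j i∈S j∈S i≢j) λ ())

emptyOrSingletons : ∀ m → List (Subset m)
emptyOrSingletons m = ⊥ ∷ tabulate ⁅_⁆

emptyOrSingletons-Unique : ∀ m → Unique (emptyOrSingletons m)
emptyOrSingletons-Unique m = All-tabulate⁺ ⊥≢⁅i⁆ ∷ tabulate⁺ ⁅⁆-injective
  where
  ⊥≢⁅i⁆ : ∀ (i : Fin m) → ⊥ ≢ ⁅ i ⁆
  ⊥≢⁅i⁆ i ⊥≡⁅i⁆ = ∉⊥ (subst (i ∈_) (sym ⊥≡⁅i⁆) (x∈⁅x⁆ i))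

  ⁅⁆-injective : ∀ {i j : Fin m} → ⁅ i ⁆ ≡ ⁅ j ⁆ → i ≡ j
  ⁅⁆-injective {i} {j} ⁅i⁆≡⁅j⁆ = x∈⁅y⁆⇒x≡y j (subst (i ∈_) ⁅i⁆≡⁅j⁆ (x∈⁅x⁆ i))

emptyGraph-isClique⇒∈emptyOrSingletons : ∀ {m} {S : Subset m} →
  IsClique (emptyGraph m) S → S ∈ₗ emptyOrSingletons m
emptyGraph-isClique⇒∈emptyOrSingletons {S = S} clique with nonempty? S
... | no  S-empty   = hereₗ (Empty-unique S-empty)
... | yes (i , i∈S) = thereₗ (subst (_∈ₗ tabulate ⁅_⁆) (sym S≡⁅i⁆) (∈-tabulate⁺ i))
  where
  S≡⁅i⁆ : S ≡ ⁅ i ⁆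
  S≡⁅i⁆ = ⊆-antisym
    (λ j∈S → subst (_∈ ⁅ i ⁆) (emptyGraph-isClique⇒≡ clique i∈S j∈S) (x∈⁅x⁆ i))
    (λ j∈⁅i⁆ → subst (_∈ S) (sym (x∈⁅y⁆⇒x≡y i j∈⁅i⁆)) i∈S)

∈emptyOrSingletons⇒emptyGraph-isClique : ∀ {m} {S : Subset m} →
  S ∈ₗ emptyOrSingletons m → IsClique (emptyGraph m) S
∈emptyOrSingletons⇒emptyGraph-isClique (hereₗ refl) i j i∈⊥ = contradiction i∈⊥ ∉⊥
∈emptyOrSingletons⇒emptyGraph-isClique (thereₗ S∈ₗ) i j i∈S j∈S i≢j with k , refl ← ∈-tabulate⁻ S∈ₗ =
  contradiction (trans (x∈⁅y⁆⇒x≡y k i∈S) (sym (x∈⁅y⁆⇒x≡y k j∈S))) i≢j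

emptyGraph-NumCliques : ∀ m → NumCliques (emptyGraph m) (suc m)
emptyGraph-NumCliques m =
  emptyOrSingletons m , emptyOrSingletons-Unique m , cong suc (length-tabulate ⁅_⁆) ,
  λ S → mk⇔ ∈emptyOrSingletons⇒emptyGraph-isClique emptyGraph-isClique⇒∈emptyOrSingletons

completeSplit-NumCliques : ∀ d m → NumCliques (completeSplit d m) (2 ^ d * suc m)
completeSplit-NumCliques zero    m =
  subst (NumCliques (emptyGraph m)) (sym (*-identityˡ (suc m))) (emptyGraph-NumCliques m)
completeSplit-NumCliques (suc d) m =
  subst (NumCliques (completeSplit (suc d) m)) (sym (*-assoc 2 (2 ^ d) (suc m)))
    (cone-NumCliques (completeSplit-NumCliques d m))

core-isClique : ∀ d m → IsClique (completeSplit d m) (core d m)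
core-isClique zero    m i j i∈⊥ = contradiction i∈⊥ ∉⊥
core-isClique (suc d) m = Equivalence.from cone-isClique⇔ (core-isClique d m)

proposition3 : (d n : ℕ) → d ≤ n →
    Σ (Graph n) λ G →
      Degenerate d G × NumCliques G (2 ^ d * (n ∸ d + 1)) ×
      ∃ λ (S : Subset n) → IsClique G S × ∣ S ∣ ≡ d
proposition3 d n d≤n with m , refl ← m≤n⇒∃[o]m+o≡n d≤n =
  completeSplit d m ,
  completeSplit-degenerate d m ,
  subst (λ k → NumCliques (completeSplit d m) (2 ^ d * k)) (sym d+m∸d+1≡1+m) (completeSplit-NumCliques d m) ,
  core d m , core-isClique d m , ∣core∣≡d d m
  where
  d+m∸d+1≡1+m : d + m ∸ d + 1 ≡ suc m
  d+m∸d+1≡1+m = trans (cong (_+ 1) (m+n∸m≡n d m)) (+-comm m 1)
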